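{- Let $(x_0,y_0),(x_1,y_1),\dots$ be the solutions in $\mathbb{N}$ of $x^2-19\,y^2=1$, listed so that $y_0<y_1<\cdots$ (so $x_1=170$, $y_1=39$); $39$ divides every $y_k$. Call a positive integer representable if it can be written as $w^2+w\,t+5\,t^2$ with $w,t\in\mathbb{Z}$. Let $n=2^m\cdot h$ with $h$ odd and $m>0$. If $y_n/39$ is representable, then $y_h/39$ is representable. -}

module Defs where

open import Data.Nat using (ℕ; zero; suc; _+_; _*_; _/_)
open import Data.Product using (_×_; _,_; proj₂; ∃-syntax)
open import Data.Integer using (ℤ; +_) renaming (_+_ to _+ℤ_; _*_ to _*ℤ_)
open import Relation.Binary.PropositionalEquality using (_≡_)

-- Solutions of x² − 19 y² = 1 in ℕ, ordered by increasing y: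
-- (x₀,y₀) = (1,0) and (x_{k+1}, y_{k+1}) = (170 x_k + 741 y_k , 39 x_k + 170 y_k),
-- i.e. x_k + y_k √19 = (170 + 39 √19)^k  (fundamental solution (170,39)).
pell : ℕ → ℕ × ℕ
pell zero = 1 , 0
pell (suc k) with pell k
... | x , y = 170 * x + 741 * y , 39 * x + 170 * y

y : ℕ → ℕ
y k = proj₂ (pell k)

Representable : ℕ → Set
Representable N = ∃[ w ] ∃[ t ] (w *ℤ w +ℤ w *ℤ t +ℤ + 5 *ℤ (t *ℤ t) ≡ + N)

{-# OPTIONS --safe #-}
module Submission where

-- Since y_{2k} = 2 x_k y_k, every divisor of y_k is prime to x_k (Pell equation) and y_h is odd,
-- y_{2^m h} = y_h · r with gcd(y_h, r) = 1, so y_n/39 = (y_h/39) · r.  It therefore suffices that the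
-- norm form N(w, t) = w² + wt + 5t² of ℤ[(1+√−19)/2] (class number one) satisfies: if a·b = N(w, t)
-- with gcd(a, b) = 1, then a is a value of N.  If t is invertible modulo a, then c = w t⁻¹ is a root
-- of c² + c + 5 modulo a, so the form (a, 2c+1, ·) has discriminant −19; Lagrange reduction takes
-- every positive definite form of discriminant −19 to (1, 1, 5), hence it represents 1, and then
-- a = N(a u + c v, v).  Otherwise a prime p divides a and t, hence w, so p² divides a and
-- (w/p, t/p) represents (a/p²)·b, which is handled by induction on a.

open import Defs
open import Data.Product using (∃-syntax; Σ-syntax; _×_; _,_; proj₁; proj₂)
open import Data.Sum using (_⊎_; inj₁; inj₂)
open import Function using (_∘_)
open import Data.Empty using (⊥-elim)
open import Relation.Nullary using (¬_; yes; no)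
open import Relation.Binary.PropositionalEquality
open import Induction.WellFounded using (Acc; acc)
open import Data.Nat.Induction using (<-wellFounded)

module Coprimality where
  open import Data.Nat using (NonZero; ≢-nonZero; ≢-nonZero⁻¹; _*_)
  open import Data.Nat.Divisibility using (_∣_; ∣-trans; m∣m*n)
  open import Data.Nat.Coprimality using (Coprime; coprime-divisor; gcd≡1⇒coprime)
  open import Data.Nat.GCD using (gcd; gcd[m,n]∣m; gcd[m,n]∣n; gcd[m,n]≢0)
  open import Data.Nat.Primality using (Prime)
  open import Data.Nat.Primality.Factorisation using (PrimeFactorisation; factorise)
  open import Data.Nat.ListAction using (product)
  open import Data.List using ([]; _∷_)
  open import Data.List.Relation.Unary.All using (_∷_)

  coprime∧∣⇒coprime : ∀ {m n d} → Coprime m n → d ∣ m → Coprime d n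
  coprime∧∣⇒coprime m⊥n d∣m (e∣d , e∣n) = m⊥n (∣-trans e∣d d∣m , e∣n)

  coprime-*ʳ : ∀ {m n o} → Coprime m n → Coprime m o → Coprime m (n * o)
  coprime-*ʳ m⊥n m⊥o (d∣m , d∣no) = m⊥o (d∣m , coprime-divisor (coprime∧∣⇒coprime m⊥n d∣m) d∣no)

  ¬coprime⇒common-prime-factor : ∀ {m n} .{{_ : NonZero m}} → ¬ Coprime m n →
                                 ∃[ p ] Prime p × p ∣ m × p ∣ n
  ¬coprime⇒common-prime-factor {m} {n} ¬m⊥n = common (factorise (gcd m n) {{≢-nonZero g≢0}})
    where
    g≢0 : gcd m n ≢ 0
    g≢0 = gcd[m,n]≢0 m n (inj₁ (≢-nonZero⁻¹ m))
    common : PrimeFactorisation (gcd m n) → ∃[ p ] Prime p × p ∣ m × p ∣ n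
    common record { factors = [] ; isFactorisation = g≡1 } = ⊥-elim (¬m⊥n (gcd≡1⇒coprime g≡1))
    common record { factors = p ∷ ps ; isFactorisation = g≡p*ps ; factorsPrime = p-prime ∷ _ } =
      p , p-prime , ∣-trans p∣g (gcd[m,n]∣m m n) , ∣-trans p∣g (gcd[m,n]∣n m n)
      where
      p∣g : p ∣ gcd m n
      p∣g = subst (p ∣_) (sym g≡p*ps) (m∣m*n (product ps))

module PellSequence where
  open import Data.Nat
  open import Data.Nat.Properties using (+-comm; +-cancelʳ-≡; *-comm; *-assoc; *-identityˡ; *-identityʳ)
  open import Data.Nat.Divisibility
  open import Data.Nat.Coprimality using (Coprime; 1-coprimeTo) renaming (sym to Coprime-sym)
  open import Data.Nat.Tactic.RingSolver using (solve-∀)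
  open Coprimality using (coprime-*ʳ)

  x : ℕ → ℕ
  x k = proj₁ (pell k)

  pell-+ : ∀ m n → x (m + n) ≡ x m * x n + 19 * (y m * y n) × y (m + n) ≡ x m * y n + y m * x n
  pell-+ zero    n = identityₓ (x n) (y n) , identityᵧ (x n) (y n)
    where
    identityₓ : ∀ a b → a ≡ 1 * a + 19 * (0 * b)
    identityₓ = solve-∀
    identityᵧ : ∀ a b → b ≡ 1 * b + 0 * a
    identityᵧ = solve-∀
  pell-+ (suc m) n =
    trans (cong₂ (λ a b → 170 * a + 741 * b) (proj₁ ih) (proj₂ ih)) (identityₓ (x m) (y m) (x n) (y n)) ,
    trans (cong₂ (λ a b → 39 * a + 170 * b) (proj₁ ih) (proj₂ ih)) (identityᵧ (x m) (y m) (x n) (y n))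
    where
    ih = pell-+ m n
    identityₓ : ∀ a b c d → 170 * (a * c + 19 * (b * d)) + 741 * (a * d + b * c)
                            ≡ (170 * a + 741 * b) * c + 19 * ((39 * a + 170 * b) * d)
    identityₓ = solve-∀
    identityᵧ : ∀ a b c d → 39 * (a * c + 19 * (b * d)) + 170 * (a * d + b * c)
                            ≡ (170 * a + 741 * b) * d + (39 * a + 170 * b) * c
    identityᵧ = solve-∀

  pell-double : ∀ k → x (2 * k) ≡ x k * x k + 19 * (y k * y k) × y (2 * k) ≡ 2 * x k * y k
  pell-double k =
    trans (cong x (identity₁ k)) (proj₁ (pell-+ k k)) ,
    trans (cong y (identity₁ k)) (trans (proj₂ (pell-+ k k)) (identity₂ (x k) (y k)))
    where
    identity₁ : ∀ k → 2 * k ≡ k + k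
    identity₁ = solve-∀
    identity₂ : ∀ a b → a * b + b * a ≡ 2 * a * b
    identity₂ = solve-∀

  pell-equation : ∀ k → x k * x k ≡ 1 + 19 * (y k * y k)
  pell-equation zero    = refl
  pell-equation (suc k) = +-cancelʳ-≡ (19 * (y k * y k)) _ _ (begin
    x′ * x′ + 19 * (y k * y k)            ≡⟨ identity₁ (x k) (y k) ⟩
    x k * x k + 19 * (y′ * y′)            ≡⟨ cong (_+ 19 * (y′ * y′)) (pell-equation k) ⟩
    1 + 19 * (y k * y k) + 19 * (y′ * y′) ≡⟨ identity₂ (y k * y k) (y′ * y′) ⟩
    1 + 19 * (y′ * y′) + 19 * (y k * y k) ∎)
    where
    open ≡-Reasoning
    x′ = x (suc k)
    y′ = y (suc k)
    -- x′² − 19 y′² = x² − 19 y², with both sides moved so that no subtraction occurs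
    identity₁ : ∀ a b → (170 * a + 741 * b) * (170 * a + 741 * b) + 19 * (b * b)
                        ≡ a * a + 19 * ((39 * a + 170 * b) * (39 * a + 170 * b))
    identity₁ = solve-∀
    identity₂ : ∀ s t → 1 + 19 * s + 19 * t ≡ 1 + 19 * t + 19 * s
    identity₂ = solve-∀

  39∣y : ∀ k → 39 ∣ y k
  39∣y zero    = 39 ∣0
  39∣y (suc k) = ∣m∣n⇒∣m+n (m∣m*n (x k)) (∣n⇒∣m*n 170 (39∣y k))

  ∣y⇒coprime-x : ∀ {d} k → d ∣ y k → Coprime d (x k)
  ∣y⇒coprime-x k d∣y {e} (e∣d , e∣x) = ∣1⇒≡1 (∣m+n∣m⇒∣n
    (subst (e ∣_) (trans (pell-equation k) (+-comm 1 _)) (∣m⇒∣m*n (x k) e∣x))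
    (∣n⇒∣m*n 19 (∣m⇒∣m*n (y k) (∣-trans e∣d d∣y))))

  y-odd : ∀ j → ∃[ e ] y (2 * j + 1) ≡ 2 * e + 1
  y-odd j = 19 + 741 * (y j * y j) + 170 * (x j * y j) , (begin
    y (2 * j + 1)
      ≡⟨ proj₂ (pell-+ (2 * j) 1) ⟩
    x (2 * j) * 39 + y (2 * j) * 170
      ≡⟨ cong₂ (λ a b → a * 39 + b * 170) (proj₁ (pell-double j)) (proj₂ (pell-double j)) ⟩
    (x j * x j + 19 * (y j * y j)) * 39 + 2 * x j * y j * 170
      ≡⟨ cong (λ a → (a + 19 * (y j * y j)) * 39 + 2 * x j * y j * 170) (pell-equation j) ⟩
    (1 + 19 * (y j * y j) + 19 * (y j * y j)) * 39 + 2 * x j * y j * 170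
      ≡⟨ identity (x j) (y j) ⟩
    2 * (19 + 741 * (y j * y j) + 170 * (x j * y j)) + 1
      ∎)
    where
    open ≡-Reasoning
    identity : ∀ a b → (1 + 19 * (b * b) + 19 * (b * b)) * 39 + 2 * a * b * 170
                       ≡ 2 * (19 + 741 * (b * b) + 170 * (a * b)) + 1
    identity = solve-∀

  y-odd-coprime-2 : ∀ j → Coprime (y (2 * j + 1)) 2
  y-odd-coprime-2 j = subst (λ n → Coprime n 2) (sym (proj₂ (y-odd j))) (odd-coprime-2 (proj₁ (y-odd j)))
    where
    odd-coprime-2 : ∀ e → Coprime (2 * e + 1) 2
    odd-coprime-2 e (d∣2e+1 , d∣2) = ∣1⇒≡1 (∣m+n∣m⇒∣n d∣2e+1 (∣m⇒∣m*n e d∣2))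

  y-2^m*-coprime-cofactor : ∀ h → Coprime (y h) 2 → ∀ m → ∃[ r ] y (2 ^ m * h) ≡ y h * r × Coprime (y h) r
  y-2^m*-coprime-cofactor h yh⊥2 zero =
    1 , trans (cong y (*-identityˡ h)) (sym (*-identityʳ (y h))) , Coprime-sym (1-coprimeTo (y h))
  y-2^m*-coprime-cofactor h yh⊥2 (suc m) with y-2^m*-coprime-cofactor h yh⊥2 m
  ... | r , y[k]≡y[h]r , yh⊥r = 2 * x k * r , (begin
    y (2 ^ suc m * h)   ≡⟨ cong y (*-assoc 2 (2 ^ m) h) ⟩
    y (2 * k)           ≡⟨ proj₂ (pell-double k) ⟩
    2 * x k * y k       ≡⟨ cong (2 * x k *_) y[k]≡y[h]r ⟩
    2 * x k * (y h * r) ≡⟨ identity (2 * x k) (y h) r ⟩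
    y h * (2 * x k * r) ∎) ,
    coprime-*ʳ (coprime-*ʳ yh⊥2 (∣y⇒coprime-x k yh∣yk)) yh⊥r
    where
    open ≡-Reasoning
    k = 2 ^ m * h
    yh∣yk : y h ∣ y k
    yh∣yk = divides r (trans y[k]≡y[h]r (*-comm (y h) r))
    identity : ∀ a b c → a * (b * c) ≡ b * (a * c)
    identity = solve-∀

module BinaryForms where
  open import Data.Nat as ℕ using (z≤n; s≤s)
  import Data.Nat.Properties as ℕ
  open import Data.Nat.DivMod using (m*n%n≡0)
  import Data.Nat.Tactic.RingSolver as ℕ-Solver
  open import Data.Integer
  open import Data.Integer.Properties using (pos-*; +-injective; m-n≡m⊖n; ⊖-≥; ∣m⊝n∣≤m⊔n)
  open import Data.Integer.DivMod using (_/ℕ_; _%ℕ_; a≡a%ℕn+[a/ℕn]*n; n%ℕd<d)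
  open import Data.Integer.Tactic.RingSolver using (solve-∀)

  record Form : Set where
    constructor form
    field a b c : ℤ

  _⟨_,_⟩ : Form → ℤ → ℤ → ℤ
  form a b c ⟨ u , v ⟩ = a * u * u + b * u * v + c * v * v

  Represents : Form → ℤ → Set
  Represents f n = ∃[ u ] ∃[ v ] f ⟨ u , v ⟩ ≡ n

  disc : Form → ℤ
  disc (form a b c) = b * b - + 4 * a * c

  shift : ℤ → Form → Form
  shift k (form a b c) = form a (b - + 2 * a * k) (a * k * k - b * k + c)

  swap : Form → Form
  swap (form a b c) = form c b a

  disc-shift : ∀ k f → disc (shift k f) ≡ disc f
  disc-shift k (form a b c) = identity a b c k
    where
    identity : ∀ a b c k →
      (b - + 2 * a * k) * (b - + 2 * a * k) - + 4 * a * (a * k * k - b * k + c) ≡ b * b - + 4 * a * c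
    identity = solve-∀

  disc-swap : ∀ f → disc (swap f) ≡ disc f
  disc-swap (form a b c) = identity a b c
    where
    identity : ∀ a b c → b * b - + 4 * c * a ≡ b * b - + 4 * a * c
    identity = solve-∀

  shift-represents : ∀ k f {n} → Represents (shift k f) n → Represents f n
  shift-represents k (form a b c) (u , v , eq) = u - k * v , v , trans (identity a b c k u v) eq
    where
    identity : ∀ a b c k u v →
      a * (u - k * v) * (u - k * v) + b * (u - k * v) * v + c * v * v
        ≡ a * u * u + (b - + 2 * a * k) * u * v + (a * k * k - b * k + c) * v * v
    identity = solve-∀

  swap-represents : ∀ f {n} → Represents (swap f) n → Represents f n
  swap-represents (form a b c) (u , v , eq) = v , u , trans (identity a b c u v) eq
    where
    identity : ∀ a b c u v → a * v * v + b * v * u + c * u * u ≡ c * u * u + b * u * v + a * v * v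
    identity = solve-∀

  represents-a : ∀ a b c → Represents (form a b c) a
  represents-a a b c = + 1 , + 0 , identity a b c
    where
    identity : ∀ a b c → a * + 1 * + 1 + b * + 1 * + 0 + c * + 0 * + 0 ≡ a
    identity = solve-∀

  centred-shift : ∀ m .{{_ : ℕ.NonZero m}} i → ∃[ k ] ∣ i - + 2 * + m * k ∣ ℕ.≤ m
  centred-shift m i = q , subst (λ j → ∣ j ∣ ℕ.≤ m) (sym i-2mq≡r-m) ∣r-m∣≤m
    where
    instance
      _ = ℕ.m*n≢0 2 m
    r = (i + + m) %ℕ (2 ℕ.* m)
    q = (i + + m) /ℕ (2 ℕ.* m)
    i-2mq≡r-m : i - + 2 * + m * q ≡ + r - + m
    i-2mq≡r-m = begin
      i - + 2 * + m * q
        ≡⟨ identity₁ i (+ m) q ⟩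
      i + + m - q * (+ 2 * + m) - + m
        ≡⟨ cong (λ j → j - q * (+ 2 * + m) - + m) (a≡a%ℕn+[a/ℕn]*n (i + + m) (2 ℕ.* m)) ⟩
      + r + q * + (2 ℕ.* m) - q * (+ 2 * + m) - + m
        ≡⟨ cong (λ j → + r + q * j - q * (+ 2 * + m) - + m) (pos-* 2 m) ⟩
      + r + q * (+ 2 * + m) - q * (+ 2 * + m) - + m
        ≡⟨ identity₂ (+ r) (q * (+ 2 * + m)) (+ m) ⟩
      + r - + m
        ∎
      where
      open ≡-Reasoning
      identity₁ : ∀ i m q → i - + 2 * m * q ≡ i + m - q * (+ 2 * m) - m
      identity₁ = solve-∀
      identity₂ : ∀ r s m → r + s - s - m ≡ r - m
      identity₂ = solve-∀
    ∣r-m∣≤m : ∣ + r - + m ∣ ℕ.≤ m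
    ∣r-m∣≤m rewrite m-n≡m⊖n r m with ℕ.≤-total m r
    ... | inj₁ m≤r rewrite ⊖-≥ m≤r =
      ℕ.<⇒≤ (ℕ.m<n+o⇒m∸n<o r m
        (subst (r ℕ.<_) (cong (m ℕ.+_) (ℕ.+-identityʳ m)) (n%ℕd<d (i + + m) (2 ℕ.* m))))
    ... | inj₂ r≤m = ℕ.≤-trans (∣m⊝n∣≤m⊔n r m) (ℕ.≤-reflexive (ℕ.m≤n⇒m⊔n≡n r≤m))

  i*i≡∣i∣*∣i∣ : ∀ i → i * i ≡ + (∣ i ∣ ℕ.* ∣ i ∣)
  i*i≡∣i∣*∣i∣ (+ n)    = sym (pos-* n n)
  i*i≡∣i∣*∣i∣ -[1+ n ] = refl

  disc≡-19⇒ : ∀ a b c → disc (form a b c) ≡ - + 19 → + 19 + b * b ≡ + 4 * a * c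
  disc≡-19⇒ a b c d = begin
    + 19 + b * b                               ≡⟨ identity₁ a b c ⟩
    + 19 + (b * b - + 4 * a * c) + + 4 * a * c ≡⟨ cong (λ δ → + 19 + δ + + 4 * a * c) d ⟩
    + 19 + - + 19 + + 4 * a * c                ≡⟨ identity₂ a c ⟩
    + 4 * a * c                                ∎
    where
    open ≡-Reasoning
    identity₁ : ∀ a b c → + 19 + b * b ≡ + 19 + (b * b - + 4 * a * c) + + 4 * a * c
    identity₁ = solve-∀
    identity₂ : ∀ a c → + 19 + - + 19 + + 4 * a * c ≡ + 4 * a * c
    identity₂ = solve-∀

  disc≡-19⇒ℕ : ∀ a b n → disc (form (+ a) b (+ n)) ≡ - + 19 →
               19 ℕ.+ ∣ b ∣ ℕ.* ∣ b ∣ ≡ 4 ℕ.* a ℕ.* n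
  disc≡-19⇒ℕ a b n d = +-injective (begin
    + 19 + + (∣ b ∣ ℕ.* ∣ b ∣) ≡⟨ cong (_+_ (+ 19)) (i*i≡∣i∣*∣i∣ b) ⟨
    + 19 + b * b               ≡⟨ disc≡-19⇒ (+ a) b (+ n) d ⟩
    + 4 * + a * + n            ≡⟨ cong (_* + n) (pos-* 4 a) ⟨
    + (4 ℕ.* a) * + n          ≡⟨ pos-* (4 ℕ.* a) n ⟨
    + (4 ℕ.* a ℕ.* n)          ∎)
    where open ≡-Reasoning

  c<0⇒disc≢-19 : ∀ a .{{_ : ℕ.NonZero a}} b n → disc (form (+ a) b -[1+ n ]) ≢ - + 19
  c<0⇒disc≢-19 (ℕ.suc a) b n d
    with trans (cong (_+_ (+ 19)) (sym (i*i≡∣i∣*∣i∣ b))) (disc≡-19⇒ (+ ℕ.suc a) b -[1+ n ] d)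
  -- the left side computes to a non-negative and the right side to a negative integer
  ... | ()

  reduced⇒a≡1 : ∀ {a b c} → b ℕ.≤ a → a ℕ.≤ c → 19 ℕ.+ b ℕ.* b ≡ 4 ℕ.* a ℕ.* c → a ≡ 1
  reduced⇒a≡1 {0} _ _ ()
  reduced⇒a≡1 {1} _ _ _ = refl
  reduced⇒a≡1 {2} {b} {c} b≤2 _ eq = ⊥-elim (19+b²≢0-mod-8 b≤2 (begin
    (19 ℕ.+ b ℕ.* b) ℕ.% 8 ≡⟨ cong (ℕ._% 8) eq ⟩
    (8 ℕ.* c) ℕ.% 8        ≡⟨ cong (ℕ._% 8) (ℕ.*-comm 8 c) ⟩
    (c ℕ.* 8) ℕ.% 8        ≡⟨ m*n%n≡0 c 8 ⟩
    0                      ∎))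
    where
    open ≡-Reasoning
    19+b²≢0-mod-8 : ∀ {b} → b ℕ.≤ 2 → (19 ℕ.+ b ℕ.* b) ℕ.% 8 ≢ 0
    19+b²≢0-mod-8 {0} _ ()
    19+b²≢0-mod-8 {1} _ ()
    19+b²≢0-mod-8 {2} _ ()
    19+b²≢0-mod-8 {ℕ.suc (ℕ.suc (ℕ.suc _))} (s≤s (s≤s ()))
  reduced⇒a≡1 {a@(ℕ.suc (ℕ.suc (ℕ.suc _)))} {b} {c} b≤a a≤c eq = ⊥-elim (ℕ.<-irrefl eq (begin-strict
    19 ℕ.+ b ℕ.* b              <⟨ ℕ.+-mono-<-≤ 19<3a² (ℕ.*-mono-≤ b≤a b≤a) ⟩
    3 ℕ.* (a ℕ.* a) ℕ.+ a ℕ.* a ≡⟨ identity a ⟩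
    4 ℕ.* a ℕ.* a               ≤⟨ ℕ.*-monoʳ-≤ (4 ℕ.* a) a≤c ⟩
    4 ℕ.* a ℕ.* c               ∎))
    where
    open ℕ.≤-Reasoning
    3≤a : 3 ℕ.≤ a
    3≤a = s≤s (s≤s (s≤s z≤n))
    19<3a² : 19 ℕ.< 3 ℕ.* (a ℕ.* a)
    19<3a² = ℕ.<-≤-trans (ℕ.m≤m+n 20 7) (ℕ.*-monoʳ-≤ 3 (ℕ.*-mono-≤ 3≤a 3≤a))
    identity : ∀ a → 3 ℕ.* (a ℕ.* a) ℕ.+ a ℕ.* a ≡ 4 ℕ.* a ℕ.* a
    identity = ℕ-Solver.solve-∀

  private
    mutual
      represents-1 : ∀ a → Acc ℕ._<_ a → .{{_ : ℕ.NonZero a}} → ∀ b c →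
                     disc (form (+ a) b c) ≡ - + 19 → Represents (form (+ a) b c) (+ 1)
      represents-1 a rs b c d with centred-shift a b
      ... | k , ∣b′∣≤a = shift-represents k f
                           (represents-1-reduced a rs (Form.b (shift k f)) (Form.c (shift k f)) ∣b′∣≤a
                             (trans (disc-shift k f) d))
        where f = form (+ a) b c

      represents-1-reduced : ∀ a → Acc ℕ._<_ a → .{{_ : ℕ.NonZero a}} → ∀ b c → ∣ b ∣ ℕ.≤ a →
                             disc (form (+ a) b c) ≡ - + 19 → Represents (form (+ a) b c) (+ 1)
      represents-1-reduced a (acc rs) b (+ n) ∣b∣≤a d with n ℕ.<? a
      ... | yes n<a = swap-represents (form (+ a) b (+ n))
                        (represents-1 n (rs n<a) {{n≢0}} b (+ a) (trans (disc-swap (form (+ a) b (+ n))) d))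
        where
        n≢0 : ℕ.NonZero n
        n≢0 = ℕ.≢-nonZero λ n≡0 → ℕ.1+n≢0 (begin
          19 ℕ.+ ∣ b ∣ ℕ.* ∣ b ∣ ≡⟨ disc≡-19⇒ℕ a b n d ⟩
          4 ℕ.* a ℕ.* n          ≡⟨ cong (4 ℕ.* a ℕ.*_) n≡0 ⟩
          4 ℕ.* a ℕ.* 0          ≡⟨ ℕ.*-zeroʳ (4 ℕ.* a) ⟩
          0                      ∎)
          where open ≡-Reasoning
      ... | no n≮a = subst (Represents (form (+ a) b (+ n))) (cong +_ a≡1) (represents-a (+ a) b (+ n))
        where
        a≡1 : a ≡ 1
        a≡1 = reduced⇒a≡1 ∣b∣≤a (ℕ.≮⇒≥ n≮a) (disc≡-19⇒ℕ a b n d)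
      represents-1-reduced a _ b -[1+ n ] _ d = ⊥-elim (c<0⇒disc≢-19 a b n d)

  disc-19⇒represents-1 : ∀ a .{{_ : ℕ.NonZero a}} b c →
                         disc (form (+ a) b c) ≡ - + 19 → Represents (form (+ a) b c) (+ 1)
  disc-19⇒represents-1 a = represents-1 a (<-wellFounded a)

module PrincipalForm where
  open import Data.Nat as ℕ using (zero; suc)
  import Data.Nat.Properties as ℕ
  import Data.Nat.Divisibility as ℕ
  open import Data.Nat.GCD using (module Bézout)
  open import Data.Nat.Coprimality using (Coprime; coprime⇒GCD≡1; coprime-divisor; coprime?)
    renaming (sym to Coprime-sym)
  open import Data.Nat.Primality using (Prime; euclidsLemma; prime⇒nonZero; prime⇒nonTrivial)
  open import Data.Integer
  open import Data.Integer.Properties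
    using (pos-*; *-identityʳ; abs-*; *-cancelˡ-≡; +∣i∣≡i⊎+∣i∣≡-i; *-comm)
  open import Data.Integer.Divisibility.Signed
    using (_∣_; divides; ∣ᵤ⇒∣; ∣⇒∣ᵤ; ∣m+n∣n⇒∣m; ∣m⇒∣m*n)
  open import Data.Integer.Tactic.RingSolver using (solve-∀)
  open BinaryForms using (form; Represents; disc-19⇒represents-1)
  open Coprimality using (coprime∧∣⇒coprime; coprime-*ʳ; ¬coprime⇒common-prime-factor)

  norm : ℤ → ℤ → ℤ
  norm w t = w * w + w * t + + 5 * (t * t)

  norm-* : ∀ w t k → norm (w * k) (t * k) ≡ k * k * norm w t
  norm-* = identity
    where
    identity : ∀ w t k → w * k * (w * k) + w * k * (t * k) + + 5 * (t * k * (t * k))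
                         ≡ k * k * (w * w + w * t + + 5 * (t * t))
    identity = solve-∀

  representable-*-square : ∀ n m → Representable n → Representable (m ℕ.* m ℕ.* n)
  representable-*-square n m (w , t , eq) = w * + m , t * + m , (begin
    norm (w * + m) (t * + m) ≡⟨ norm-* w t (+ m) ⟩
    + m * + m * norm w t     ≡⟨ cong (+ m * + m *_) eq ⟩
    + m * + m * + n          ≡⟨ cong (_* + n) (pos-* m m) ⟨
    + (m ℕ.* m) * + n        ≡⟨ pos-* (m ℕ.* m) n ⟨
    + (m ℕ.* m ℕ.* n)        ∎)
    where open ≡-Reasoning

  ∣c²+c+5⇒representable : ∀ a .{{_ : ℕ.NonZero a}} c q → c * c + c + + 5 ≡ + a * q → Representable a
  ∣c²+c+5⇒representable a c q eq = representable (disc-19⇒represents-1 a B q disc≡-19)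
    where
    open ≡-Reasoning
    A = + a
    B = + 2 * c + + 1
    disc≡-19 : B * B - + 4 * A * q ≡ - + 19
    disc≡-19 = begin
      B * B - + 4 * A * q                            ≡⟨ identity₁ c A q ⟩
      + 4 * (c * c + c + + 5) - + 4 * (A * q) - + 19 ≡⟨ cong (λ z → + 4 * z - + 4 * (A * q) - + 19) eq ⟩
      + 4 * (A * q) - + 4 * (A * q) - + 19           ≡⟨ identity₂ (+ 4 * (A * q)) ⟩
      - + 19                                         ∎
      where
      identity₁ : ∀ c A q → (+ 2 * c + + 1) * (+ 2 * c + + 1) - + 4 * A * q
                            ≡ + 4 * (c * c + c + + 5) - + 4 * (A * q) - + 19
      identity₁ = solve-∀
      identity₂ : ∀ z → z - z - + 19 ≡ - + 19
      identity₂ = solve-∀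
    representable : Represents (form A B q) (+ 1) → Representable a
    representable (u , v , eq′) = A * u + c * v , v , (begin
      norm (A * u + c * v) v
        ≡⟨ identity₁ A c u v ⟩
      A * (A * u * u + B * u * v) + (c * c + c + + 5) * (v * v)
        ≡⟨ cong (λ z → A * (A * u * u + B * u * v) + z * (v * v)) eq ⟩
      A * (A * u * u + B * u * v) + A * q * (v * v)
        ≡⟨ identity₂ A B q u v ⟩
      A * (A * u * u + B * u * v + q * v * v)
        ≡⟨ cong (A *_) eq′ ⟩
      A * + 1
        ≡⟨ *-identityʳ A ⟩
      A ∎)
      where
      identity₁ : ∀ A c u v → (A * u + c * v) * (A * u + c * v) + (A * u + c * v) * v + + 5 * (v * v)
                  ≡ A * (A * u * u + (+ 2 * c + + 1) * u * v) + (c * c + c + + 5) * (v * v)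
      identity₁ = solve-∀
      identity₂ : ∀ A B q u v → A * (A * u * u + B * u * v) + A * q * (v * v)
                                ≡ A * (A * u * u + B * u * v + q * v * v)
      identity₂ = solve-∀

  coprime⇒invertible : ∀ a t → Coprime a ∣ t ∣ → ∃[ s ] ∃[ k ] s * t ≡ + 1 + k * + a
  coprime⇒invertible a t a⊥t =
    with-sign (invertible-∣t∣ (Bézout.identity (coprime⇒GCD≡1 a⊥t))) (+∣i∣≡i⊎+∣i∣≡-i t)
    where
    lift : ∀ d n m x y → d ℕ.+ y ℕ.* n ≡ x ℕ.* m → + d + + y * + n ≡ + x * + m
    lift d n m x y eq rewrite sym (pos-* y n) | sym (pos-* x m) = cong +_ eq
    invertible-∣t∣ : Bézout.Identity 1 a ∣ t ∣ → ∃[ s ] ∃[ k ] s * + ∣ t ∣ ≡ + 1 + k * + a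
    invertible-∣t∣ (Bézout.+- x y eq) = - + y , - + x , (begin
      - + y * + ∣ t ∣             ≡⟨ identity₁ (+ y) (+ ∣ t ∣) ⟩
      + 1 - (+ 1 + + y * + ∣ t ∣) ≡⟨ cong (λ z → + 1 - z) (lift 1 ∣ t ∣ a x y eq) ⟩
      + 1 - + x * + a             ≡⟨ identity₂ (+ x) (+ a) ⟩
      + 1 + - + x * + a           ∎)
      where
      open ≡-Reasoning
      identity₁ : ∀ y n → - y * n ≡ + 1 - (+ 1 + y * n)
      identity₁ = solve-∀
      identity₂ : ∀ x a → + 1 - x * a ≡ + 1 + - x * a
      identity₂ = solve-∀
    invertible-∣t∣ (Bézout.-+ x y eq) = + y , + x , sym (lift 1 a ∣ t ∣ y x eq)
    with-sign : (∃[ s ] ∃[ k ] s * + ∣ t ∣ ≡ + 1 + k * + a) → + ∣ t ∣ ≡ t ⊎ + ∣ t ∣ ≡ - t →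
                ∃[ s ] ∃[ k ] s * t ≡ + 1 + k * + a
    with-sign (s , k , eq) (inj₁ ∣t∣≡t)  = s , k , subst (λ z → s * z ≡ + 1 + k * + a) ∣t∣≡t eq
    with-sign (s , k , eq) (inj₂ ∣t∣≡-t) =
      - s , k , trans (identity s t) (subst (λ z → s * z ≡ + 1 + k * + a) ∣t∣≡-t eq)
      where
      identity : ∀ s t → - s * t ≡ s * - t
      identity = solve-∀

  coprime⇒representable : ∀ a .{{_ : ℕ.NonZero a}} b w t → Coprime a ∣ t ∣ → norm w t ≡ + (a ℕ.* b) →
                          Representable a
  coprime⇒representable a b w t a⊥t eq = from-inverse (coprime⇒invertible a t a⊥t)
    where
    from-inverse : (∃[ s ] ∃[ k ] s * t ≡ + 1 + k * + a) → Representable a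
    from-inverse (s , k , st≡1+ka) = ∣c²+c+5⇒representable a (w * s) (s * s * + b - k * X) (begin
      w * s * (w * s) + w * s + + 5                     ≡⟨ identity₁ w t s ⟩
      s * s * norm w t + (+ 1 - s * t) * X              ≡⟨ cong₂ (λ N st → s * s * N + (+ 1 - st) * X)
                                                             (trans eq (pos-* a b)) st≡1+ka ⟩
      s * s * (+ a * + b) + (+ 1 - (+ 1 + k * + a)) * X ≡⟨ identity₂ s (+ a) (+ b) k X ⟩
      + a * (s * s * + b - k * X)                       ∎)
      where
      open ≡-Reasoning
      X = w * s + + 5 + + 5 * (s * t)
      identity₁ : ∀ w t s → w * s * (w * s) + w * s + + 5
                  ≡ s * s * (w * w + w * t + + 5 * (t * t)) + (+ 1 - s * t) * (w * s + + 5 + + 5 * (s * t))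
      identity₁ = solve-∀
      identity₂ : ∀ s a b k X → s * s * (a * b) + (+ 1 - (+ 1 + k * a)) * X ≡ a * (s * s * b - k * X)
      identity₂ = solve-∀

  prime∣square⇒prime∣ : ∀ {p} w → Prime p → + p ∣ w * w → + p ∣ w
  prime∣square⇒prime∣ {p} w p-prime p∣w²
    with euclidsLemma ∣ w ∣ ∣ w ∣ p-prime (subst (p ℕ.∣_) (abs-* w w) (∣⇒∣ᵤ p∣w²))
  ... | inj₁ p∣w = ∣ᵤ⇒∣ p∣w
  ... | inj₂ p∣w = ∣ᵤ⇒∣ p∣w

  norm-descent : ∀ {p} w t → Prime p → + p ∣ t → + p ∣ norm w t →
                 ∃[ w′ ] ∃[ t′ ] norm w t ≡ + (p ℕ.* p) * norm w′ t′
  norm-descent {p} w t p-prime p∣t p∣N = descend (prime∣square⇒prime∣ w p-prime p∣w²) p∣t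
    where
    identity : ∀ w t → w * w + w * t + + 5 * (t * t) ≡ w * w + t * (w + + 5 * t)
    identity = solve-∀
    p∣w² : + p ∣ w * w
    p∣w² = ∣m+n∣n⇒∣m (subst (+ p ∣_) (identity w t) p∣N) (∣m⇒∣m*n (w + + 5 * t) p∣t)
    descend : + p ∣ w → + p ∣ t → ∃[ w′ ] ∃[ t′ ] norm w t ≡ + (p ℕ.* p) * norm w′ t′
    descend (divides w′ w≡w′p) (divides t′ t≡t′p) = w′ , t′ , (begin
      norm w t                   ≡⟨ cong₂ norm w≡w′p t≡t′p ⟩
      norm (w′ * + p) (t′ * + p) ≡⟨ norm-* w′ t′ (+ p) ⟩
      + p * + p * norm w′ t′     ≡⟨ cong (_* norm w′ t′) (pos-* p p) ⟨
      + (p ℕ.* p) * norm w′ t′   ∎)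
      where open ≡-Reasoning

  coprime-descent : ∀ {p a b} w t → Prime p → p ℕ.∣ a → + p ∣ t → Coprime a b →
                    norm w t ≡ + (a ℕ.* b) →
                    Σ[ p²∣a ∈ p ℕ.* p ℕ.∣ a ] Representable (ℕ.quotient p²∣a ℕ.* b)
  coprime-descent {p} {a} {b} w t p-prime p∣a p∣t a⊥b eq = descend (norm-descent w t p-prime p∣t p∣N)
    where
    instance
      _ = prime⇒nonZero p-prime
      _ = ℕ.m*n≢0 p p
    p∣N : + p ∣ norm w t
    p∣N = subst (+ p ∣_) (sym eq) (∣ᵤ⇒∣ (ℕ.∣m⇒∣m*n b p∣a))
    p²⊥b : Coprime (p ℕ.* p) b
    p²⊥b = Coprime-sym (coprime-*ʳ (Coprime-sym p⊥b) (Coprime-sym p⊥b))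
      where p⊥b = coprime∧∣⇒coprime a⊥b p∣a
    descend : ∃[ w′ ] ∃[ t′ ] norm w t ≡ + (p ℕ.* p) * norm w′ t′ →
              Σ[ p²∣a ∈ p ℕ.* p ℕ.∣ a ] Representable (ℕ.quotient p²∣a ℕ.* b)
    descend (w′ , t′ , N≡p²N′) = p²∣a , w′ , t′ , *-cancelˡ-≡ (+ (p ℕ.* p)) _ _ (begin
      + (p ℕ.* p) * norm w′ t′  ≡⟨ trans (sym N≡p²N′) eq ⟩
      + (a ℕ.* b)               ≡⟨ cong (λ n → + (n ℕ.* b)) (ℕ.m∣n⇒n≡m*quotient p²∣a) ⟩
      + (p ℕ.* p ℕ.* q ℕ.* b)   ≡⟨ cong +_ (ℕ.*-assoc (p ℕ.* p) q b) ⟩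
      + (p ℕ.* p ℕ.* (q ℕ.* b)) ≡⟨ pos-* (p ℕ.* p) (q ℕ.* b) ⟩
      + (p ℕ.* p) * + (q ℕ.* b) ∎)
      where
      open ≡-Reasoning
      p²∣ba : p ℕ.* p ℕ.∣ b ℕ.* a
      p²∣ba = subst (p ℕ.* p ℕ.∣_) (ℕ.*-comm a b) (∣⇒∣ᵤ (divides (norm w′ t′)
                (trans (trans (sym eq) N≡p²N′) (*-comm (+ (p ℕ.* p)) (norm w′ t′)))))
      p²∣a : p ℕ.* p ℕ.∣ a
      p²∣a = coprime-divisor p²⊥b p²∣ba
      q = ℕ.quotient p²∣a

  representable-coprime-factor : ∀ a b → Coprime a b → Representable (a ℕ.* b) → Representable a
  representable-coprime-factor a b = go a (<-wellFounded a)
    where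
    go : ∀ a → Acc ℕ._<_ a → Coprime a b → Representable (a ℕ.* b) → Representable a
    go zero _ _ _ = + 0 , + 0 , refl
    go a@(suc _) (acc rs) a⊥b (w , t , eq) with coprime? a ∣ t ∣
    ... | yes a⊥t = coprime⇒representable a b w t a⊥t eq
    ... | no ¬a⊥t = descend (¬coprime⇒common-prime-factor ¬a⊥t)
      where
      descend : ∃[ p ] Prime p × p ℕ.∣ a × p ℕ.∣ ∣ t ∣ → Representable a
      descend (p , p-prime , p∣a , p∣t) = recurse (coprime-descent w t p-prime p∣a (∣ᵤ⇒∣ p∣t) a⊥b eq)
        where
        instance
          _ = prime⇒nonZero p-prime
          _ = prime⇒nonTrivial p-prime
          _ = ℕ.m≢0∧n>1⇒m*n>1 p p
        recurse : Σ[ p²∣a ∈ p ℕ.* p ℕ.∣ a ] Representable (ℕ.quotient p²∣a ℕ.* b) → Representable a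
        recurse (p²∣a , rep) = subst Representable (sym (ℕ.m∣n⇒n≡m*quotient p²∣a))
          (representable-*-square _ p
            (go _ (rs (ℕ.quotient-< p²∣a)) (coprime∧∣⇒coprime a⊥b (ℕ.quotient-∣ p²∣a)) rep))

open import Data.Nat using (ℕ; NonZero; _+_; _*_; _^_; _/_; _<_)
open import Data.Nat.Properties using (*-comm; *-assoc)
open import Data.Nat.DivMod using (m*n/n≡m)
open import Data.Nat.Divisibility using (_∣_; divides)
open import Data.Nat.Coprimality using (Coprime)
open Coprimality using (coprime∧∣⇒coprime)
open PellSequence using (39∣y; y-odd-coprime-2; y-2^m*-coprime-cofactor)
open PrincipalForm using (representable-coprime-factor)

representable-/-coprime-factor : ∀ {A r d} .{{_ : NonZero d}} → d ∣ A → Coprime A r →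
                                 Representable (A * r / d) → Representable (A / d)
representable-/-coprime-factor {A} {r} {d} (divides q A≡qd) A⊥r rep =
  subst Representable (sym A/d≡q) (representable-coprime-factor q r q⊥r (subst Representable Ar/d≡qr rep))
  where
  open ≡-Reasoning
  A/d≡q : A / d ≡ q
  A/d≡q = trans (cong (_/ d) A≡qd) (m*n/n≡m q d)
  Ar/d≡qr : A * r / d ≡ q * r
  Ar/d≡qr = begin
    A * r / d       ≡⟨ cong (λ n → n * r / d) A≡qd ⟩
    q * d * r / d   ≡⟨ cong (_/ d) (*-assoc q d r) ⟩
    q * (d * r) / d ≡⟨ cong (λ n → q * n / d) (*-comm d r) ⟩
    q * (r * d) / d ≡⟨ cong (_/ d) (*-assoc q r d) ⟨
    q * r * d / d   ≡⟨ m*n/n≡m (q * r) d ⟩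
    q * r           ∎
  q⊥r : Coprime q r
  q⊥r = coprime∧∣⇒coprime A⊥r (divides d (trans A≡qd (*-comm q d)))

lemma3 : (m j : ℕ) → 0 < m → Representable (y (2 ^ m * (2 * j + 1)) / 39) → Representable (y (2 * j + 1) / 39)
lemma3 m j _ = from-cofactor (y-2^m*-coprime-cofactor h (y-odd-coprime-2 j) m)
  where
  h = 2 * j + 1
  from-cofactor : ∃[ r ] y (2 ^ m * h) ≡ y h * r × Coprime (y h) r →
                  Representable (y (2 ^ m * h) / 39) → Representable (y h / 39)
  from-cofactor (r , y[n]≡y[h]r , yh⊥r) =
    representable-/-coprime-factor (39∣y h) yh⊥r ∘ subst (λ n → Representable (n / 39)) y[n]≡y[h]r
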